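{- Let $f=\sum_{i,j\in[n]}a_{ij}x_{i\to j}$ be a linear function in normalized form and let $g=\sum_{i,j}b_{ij}x_{i\to j}$ be an arbitrary linear function on $S_n$. Then \[\langle f,g\rangle=\frac{\sum_{i,j}a_{ij}b_{ij}}{n-1}.\]
   Context: For $i,j\in[n]$, $x_{i\to j}\colon S_n\to\{0,1\}$ is $x_{i\to j}(\pi)=1_{\pi(i)=j}$. A linear function is a real linear combination $\sum_{i,j}a_{ij}x_{i\to j}$; it is in normalized form if $\sum_j a_{ij}=0$ for every $i$ and $\sum_i a_{ij}=0$ for every $j$. $\langle u,v\rangle=\mathbb{E}_{\sigma\sim S_n}[u(\sigma)v(\sigma)]$.
   Formalization: The coefficients $a_{ij}$ and $b_{ij}$ of both linear functions are rational rather than real. -}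

module Defs where

open import Data.Nat using (ℕ; zero; suc)
open import Data.Fin using (Fin)
open import Data.Fin.Properties using (_≟_; all?)
open import Data.Vec using (Vec; []; _∷_; lookup)
open import Data.List using (List; []; _∷_; [_]; map; concatMap; filter; foldr; length)
open import Data.List.Base using (allFin)
open import Data.Integer using (+_)
open import Data.Rational using (ℚ; 0ℚ; 1ℚ; _+_; _*_; _/_)
open import Relation.Nullary.Decidable using (_→-dec_; yes; no)
open import Relation.Binary.PropositionalEquality using (_≡_)

Σ[_] : (n : ℕ) → (Fin n → ℚ) → ℚ
Σ[ n ] f = foldr (λ i acc → f i + acc) 0ℚ (allFin n)

allVecs : (n k : ℕ) → List (Vec (Fin n) k)
allVecs n zero = [ [] ]
allVecs n (suc k) = concatMap (λ i → map (i ∷_) (allVecs n k)) (allFin n)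

-- A map [n] → [n] (given by its table) is a permutation iff it is injective.
IsPerm : {n : ℕ} → Vec (Fin n) n → Set
IsPerm {n} v = ∀ (i j : Fin n) → lookup v i ≡ lookup v j → i ≡ j

Sym : (n : ℕ) → List (Vec (Fin n) n)
Sym n = filter (λ v → all? (λ i → all? (λ j → (lookup v i ≟ lookup v j) →-dec (i ≟ j)))) (allVecs n n)

-- q / k in ℚ (with the junk value 0 when k = 0).
divBy : ℚ → ℕ → ℚ
divBy q zero = 0ℚ
divBy q (suc k) = q * ((+ 1) / suc k)

x : {n : ℕ} → Fin n → Fin n → Vec (Fin n) n → ℚ
x i j π with lookup π i ≟ j
... | yes _ = 1ℚ
... | no _ = 0ℚ

linFun : {n : ℕ} → (Fin n → Fin n → ℚ) → Vec (Fin n) n → ℚ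
linFun {n} a π = Σ[ n ] (λ i → Σ[ n ] (λ j → a i j * x i j π))

Normalized : {n : ℕ} → (Fin n → Fin n → ℚ) → Set
Normalized {n} a = (∀ i → Σ[ n ] (λ j → a i j) ≡ 0ℚ) × (∀ j → Σ[ n ] (λ i → a i j) ≡ 0ℚ)
  where open import Data.Product using (_×_)

inner : {n : ℕ} → (Vec (Fin n) n → ℚ) → (Vec (Fin n) n → ℚ) → ℚ
inner {n} u v = divBy (foldr (λ σ acc → u σ * v σ + acc) 0ℚ (Sym n)) (length (Sym n))

{-# OPTIONS --safe #-}
module Submission where

-- Expanding f and g, the sum of f g over S_n is Σ a_ij b_kl J(i,j,k,l), where J(i,j,k,l) counts the
-- permutations with π(i) = j and π(k) = l. Relabelling values by a transposition shows that J only
-- depends on which of i = k and j = l hold: with N = n!/n the number of permutations with π(k) = l,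
-- (n - 1) J is (n - 1) N if (i,j) = (k,l), 0 if exactly one of i = k, j = l holds, and N otherwise.
-- Against this kernel the vanishing row and column sums of a leave only the entry a_kl, with total
-- weight (n - 1) N + N = n!, so (n - 1) Σ_π f g = n! Σ a_kl b_kl.

open import Defs
open import Data.Nat using (ℕ; _≤_; _∸_)
open import Data.Fin using (Fin)
open import Data.Rational using (ℚ; _*_)
open import Relation.Binary.PropositionalEquality using (_≡_)

open import Algebra.Bundles using (CommutativeMonoid)
import Algebra.Properties.CommutativeMonoid.Sum as CommutativeMonoidSum
open import Data.Bool using (true; false; if_then_else_)
open import Data.Fin using (zero; suc)
open import Data.Fin.Permutation using (Permutation′; _⟨$⟩ʳ_; transpose)
open import Data.Fin.Properties using (_≟_; all?)
import Data.Integer as ℤ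
import Data.Integer.Properties as ℤ
open import Data.List using (List; []; _∷_; _++_; map; concatMap; filter; foldr; length)
open import Data.List.Base using (allFin)
open import Data.List.Membership.Propositional using (_∈_; lose)
open import Data.List.Membership.Propositional.Properties
  using (∈-filter⁺; ∈-filter⁻; ∈-concatMap⁺; ∈-map⁺; ∈-allFin)
open import Data.List.Properties using (map-tabulate; length-tabulate)
open import Data.List.Relation.Unary.Any using (here; there)
import Data.Nat as ℕ
open import Data.Nat using (zero; suc; s≤s; z≤n)
open import Data.Nat.Coprimality using (1-coprimeTo) renaming (sym to coprime-sym)
open import Data.Product using (_,_; proj₂)
open import Data.Rational using (NonZero; mkℚ; 0ℚ; 1ℚ; _+_; -_; _-_; 1/_)
open import Data.Rational.Properties
  using (+-identityˡ; +-identityʳ; +-assoc; *-zeroˡ; *-zeroʳ; *-identityˡ; *-identityʳ; *-comm; *-assoc;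
         *-distribˡ-+; *-inverseʳ; /-cong; ↥p/↧p≡p; +-0-commutativeMonoid; *-1-commutativeMonoid)
open import Algebra.Properties.CommutativeSemigroup (CommutativeMonoid.commutativeSemigroup *-1-commutativeMonoid)
  using (x∙yz≈y∙xz)
open import Data.Rational.Solver using (module +-*-Solver)
import Data.Vec as V
import Data.Vec.Properties as V
open import Function using (_∘_; id; const)
open import Function.Bundles using (Injection)
open import Function.Properties.Inverse using (↔⇒↣)
open import Relation.Nullary using (Dec; yes; no; does; contradiction)
open import Relation.Nullary.Decidable using (dec-true; dec-false; _→-dec_)
open import Relation.Binary.PropositionalEquality
  using (refl; sym; trans; cong; cong₂; _≢_; module ≡-Reasoning)

open +-*-Solver using (solve; _:=_; con; _:+_; _:*_; _:-_)
open ≡-Reasoning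

ℕ→ℚ : ℕ → ℚ
ℕ→ℚ n = mkℚ (ℤ.+ n) 0 (coprime-sym (1-coprimeTo n))

ℕ→ℚ-suc : ∀ n → ℕ→ℚ (suc n) ≡ 1ℚ + ℕ→ℚ n
ℕ→ℚ-suc n = sym (trans (/-cong (cong (ℤ._+_ (ℤ.+ 1)) (ℤ.*-identityʳ (ℤ.+ n))) refl)
                       (↥p/↧p≡p (ℕ→ℚ (suc n))))

divBy-suc : ∀ q k → divBy q (suc k) ≡ q * 1/ ℕ→ℚ (suc k)
divBy-suc q k = cong (q *_) (↥p/↧p≡p (1/ ℕ→ℚ (suc k)))

divBy-cross : ∀ {X Y} d e .{{_ : ℕ.NonZero d}} .{{_ : ℕ.NonZero e}} →
              ℕ→ℚ d * X ≡ ℕ→ℚ e * Y → divBy X e ≡ divBy Y d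
divBy-cross {X} {Y} (suc d) (suc e) dX≡eY = begin
  divBy X (suc e)              ≡⟨ divBy-suc X e ⟩
  X * e⁻¹                      ≡˘⟨ cancel (X * e⁻¹) D ⟩
  X * e⁻¹ * (D * d⁻¹)          ≡⟨ swap₁ X e⁻¹ D d⁻¹ ⟩
  (D * X) * (e⁻¹ * d⁻¹)        ≡⟨ cong (_* (e⁻¹ * d⁻¹)) dX≡eY ⟩
  (E * Y) * (e⁻¹ * d⁻¹)        ≡˘⟨ swap₂ Y d⁻¹ E e⁻¹ ⟩
  Y * d⁻¹ * (E * e⁻¹)          ≡⟨ cancel (Y * d⁻¹) E ⟩
  Y * d⁻¹                      ≡˘⟨ divBy-suc Y d ⟩
  divBy Y (suc d)              ∎
  where
  D = ℕ→ℚ (suc d)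
  E = ℕ→ℚ (suc e)
  d⁻¹ = 1/ D
  e⁻¹ = 1/ E
  cancel : ∀ q p .{{_ : NonZero p}} → q * (p * 1/ p) ≡ q
  cancel q p = trans (cong (q *_) (*-inverseʳ p)) (*-identityʳ q)
  swap₁ : ∀ a b c d → a * b * (c * d) ≡ (c * a) * (b * d)
  swap₁ = solve 4 (λ a b c d → a :* b :* (c :* d) := (c :* a) :* (b :* d)) refl
  swap₂ : ∀ a b c d → a * b * (c * d) ≡ (c * a) * (d * b)
  swap₂ = solve 4 (λ a b c d → a :* b :* (c :* d) := (c :* a) :* (d :* b)) refl

-- Finite sums

sumOver : {A : Set} → List A → (A → ℚ) → ℚ
sumOver L f = foldr (λ a acc → f a + acc) 0ℚ L

𝟙 : {P : Set} → Dec P → ℚ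
𝟙 P? = if does P? then 1ℚ else 0ℚ

𝟙-cong : {P Q : Set} → (P → Q) → (Q → P) → (P? : Dec P) (Q? : Dec Q) → 𝟙 P? ≡ 𝟙 Q?
𝟙-cong P→Q Q→P (yes _) (yes _) = refl
𝟙-cong P→Q Q→P (no _)  (no _)  = refl
𝟙-cong P→Q Q→P (yes p) (no ¬q) = contradiction (P→Q p) ¬q
𝟙-cong P→Q Q→P (no ¬p) (yes q) = contradiction (Q→P q) ¬p

module _ {A : Set} where

  sumOver-cong-∈ : ∀ L {f g : A → ℚ} → (∀ {a} → a ∈ L → f a ≡ g a) → sumOver L f ≡ sumOver L g
  sumOver-cong-∈ []      f≡g = refl
  sumOver-cong-∈ (a ∷ L) f≡g = cong₂ _+_ (f≡g (here refl)) (sumOver-cong-∈ L (f≡g ∘ there))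

  sumOver-cong : ∀ L {f g : A → ℚ} → (∀ a → f a ≡ g a) → sumOver L f ≡ sumOver L g
  sumOver-cong L f≡g = sumOver-cong-∈ L (λ {a} _ → f≡g a)

  sumOver-const : ∀ L c → sumOver {A} L (const c) ≡ ℕ→ℚ (length L) * c
  sumOver-const []      c = sym (*-zeroˡ c)
  sumOver-const (a ∷ L) c = begin
    c + sumOver L (const c)          ≡⟨ cong (c +_) (sumOver-const L c) ⟩
    c + ℕ→ℚ (length L) * c           ≡⟨ factor c (ℕ→ℚ (length L)) ⟩
    (1ℚ + ℕ→ℚ (length L)) * c        ≡˘⟨ cong (_* c) (ℕ→ℚ-suc (length L)) ⟩
    ℕ→ℚ (length (a ∷ L)) * c         ∎
    where
    factor : ∀ c m → c + m * c ≡ (1ℚ + m) * c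
    factor = solve 2 (λ c m → c :+ m :* c := (con 1ℚ :+ m) :* c) refl

  sumOver-zero : ∀ L → sumOver {A} L (const 0ℚ) ≡ 0ℚ
  sumOver-zero L = trans (sumOver-const L 0ℚ) (*-zeroʳ (ℕ→ℚ (length L)))

  sumOver-+ : ∀ L (f g : A → ℚ) → sumOver L (λ a → f a + g a) ≡ sumOver L f + sumOver L g
  sumOver-+ []      f g = refl
  sumOver-+ (a ∷ L) f g = trans (cong ((f a + g a) +_) (sumOver-+ L f g))
    (solve 4 (λ p q r s → (p :+ q) :+ (r :+ s) := (p :+ r) :+ (q :+ s)) refl (f a) (g a) _ _)

  sumOver-*ˡ : ∀ L c (f : A → ℚ) → sumOver L (λ a → c * f a) ≡ c * sumOver L f
  sumOver-*ˡ []      c f = sym (*-zeroʳ c)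
  sumOver-*ˡ (a ∷ L) c f = trans (cong (c * f a +_) (sumOver-*ˡ L c f)) (sym (*-distribˡ-+ c (f a) _))

  sumOver-*ʳ : ∀ L c (f : A → ℚ) → sumOver L (λ a → f a * c) ≡ sumOver L f * c
  sumOver-*ʳ L c f = begin
    sumOver L (λ a → f a * c)     ≡⟨ sumOver-cong L (λ a → *-comm (f a) c) ⟩
    sumOver L (λ a → c * f a)     ≡⟨ sumOver-*ˡ L c f ⟩
    c * sumOver L f               ≡⟨ *-comm c (sumOver L f) ⟩
    sumOver L f * c               ∎

  sumOver-linear : ∀ L α β (f g : A → ℚ) →
                   sumOver L (λ a → α * f a + β * g a) ≡ α * sumOver L f + β * sumOver L g
  sumOver-linear L α β f g = trans (sumOver-+ L (λ a → α * f a) (λ a → β * g a))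
                                   (cong₂ _+_ (sumOver-*ˡ L α f) (sumOver-*ˡ L β g))

  sumOver-++ : ∀ L M (f : A → ℚ) → sumOver (L ++ M) f ≡ sumOver L f + sumOver M f
  sumOver-++ []      M f = sym (+-identityˡ _)
  sumOver-++ (a ∷ L) M f = trans (cong (f a +_) (sumOver-++ L M f)) (sym (+-assoc (f a) _ _))

  sumOver-filter : ∀ {P : A → Set} (P? : ∀ a → Dec (P a)) L f →
                   sumOver (filter P? L) f ≡ sumOver L (λ a → 𝟙 (P? a) * f a)
  sumOver-filter P? []      f = refl
  sumOver-filter P? (a ∷ L) f with does (P? a)
  ... | true  = cong₂ _+_ (sym (*-identityˡ (f a))) (sumOver-filter P? L f)
  ... | false = trans (sumOver-filter P? L f) (sym (trans (cong (_+ _) (*-zeroˡ (f a))) (+-identityˡ _)))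

module _ {A B : Set} where

  sumOver-map : ∀ (g : A → B) L f → sumOver (map g L) f ≡ sumOver L (f ∘ g)
  sumOver-map g []      f = refl
  sumOver-map g (a ∷ L) f = cong (f (g a) +_) (sumOver-map g L f)

  sumOver-concatMap : ∀ (g : A → List B) L f → sumOver (concatMap g L) f ≡ sumOver L (λ a → sumOver (g a) f)
  sumOver-concatMap g []      f = refl
  sumOver-concatMap g (a ∷ L) f =
    trans (sumOver-++ (g a) (concatMap g L) f) (cong (sumOver (g a) f +_) (sumOver-concatMap g L f))

  sumOver-comm : ∀ L M (h : A → B → ℚ) →
                 sumOver L (λ a → sumOver M (h a)) ≡ sumOver M (λ b → sumOver L (λ a → h a b))
  sumOver-comm []      M h = sym (sumOver-zero M)
  sumOver-comm (a ∷ L) M h =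
    trans (cong (sumOver M (h a) +_) (sumOver-comm L M h)) (sym (sumOver-+ M (h a) _))

Σ-cong : ∀ {n} {f g : Fin n → ℚ} → (∀ i → f i ≡ g i) → Σ[ n ] f ≡ Σ[ n ] g
Σ-cong {n} = sumOver-cong (allFin n)

Σ-suc : ∀ {n} (f : Fin (suc n) → ℚ) → Σ[ suc n ] f ≡ f zero + Σ[ n ] (f ∘ suc)
Σ-suc {n} f = cong (f zero +_)
  (trans (cong (λ L → sumOver L f) (sym (map-tabulate id suc))) (sumOver-map suc (allFin n) f))

Σ-const : ∀ {n} (c : ℚ) → Σ[ n ] (const c) ≡ ℕ→ℚ n * c
Σ-const {n} c = trans (sumOver-const (allFin n) c) (cong (λ k → ℕ→ℚ k * c) (length-tabulate id))

module ℚSum = CommutativeMonoidSum +-0-commutativeMonoid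

Σ≡sum : ∀ {n} (f : Fin n → ℚ) → Σ[ n ] f ≡ ℚSum.sum f
Σ≡sum {zero}  f = refl
Σ≡sum {suc n} f = trans (Σ-suc f) (cong (f zero +_) (Σ≡sum (f ∘ suc)))

Σ-permute : ∀ {n} (σ : Permutation′ n) (f : Fin n → ℚ) → Σ[ n ] (f ∘ (σ ⟨$⟩ʳ_)) ≡ Σ[ n ] f
Σ-permute σ f = trans (Σ≡sum (f ∘ (σ ⟨$⟩ʳ_))) (trans (sym (ℚSum.sum-permute f σ)) (sym (Σ≡sum f)))

Σ²-*ˡ : ∀ {n} c (F : Fin n → Fin n → ℚ) →
        c * Σ[ n ] (λ i → Σ[ n ] (F i)) ≡ Σ[ n ] (λ i → Σ[ n ] (λ j → c * F i j))
Σ²-*ˡ {n} c F = trans (sym (sumOver-*ˡ (allFin n) c (λ i → Σ[ n ] (F i))))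
                      (Σ-cong (λ i → sym (sumOver-*ˡ (allFin n) c (F i))))

-- The Kronecker delta

δ : ∀ {n} → Fin n → Fin n → ℚ
δ i j = 𝟙 (i ≟ j)

δ-refl : ∀ {n} (i : Fin n) → δ i i ≡ 1ℚ
δ-refl i = cong (if_then 1ℚ else 0ℚ) (dec-true (i ≟ i) refl)

δ-≢ : ∀ {n} {i j : Fin n} → i ≢ j → δ i j ≡ 0ℚ
δ-≢ {i = i} {j} i≢j = cong (if_then 1ℚ else 0ℚ) (dec-false (i ≟ j) i≢j)

δ-sym : ∀ {n} (i j : Fin n) → δ i j ≡ δ j i
δ-sym i j = 𝟙-cong sym sym (i ≟ j) (j ≟ i)

δ-mul-same : ∀ {n} (a j l : Fin n) → δ a j * δ a l ≡ δ j l * δ a l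
δ-mul-same a j l with a ≟ l
... | yes refl = cong (_* 1ℚ) (δ-sym a j)
... | no _     = trans (*-zeroʳ (δ a j)) (sym (*-zeroʳ (δ j l)))

δ-mul-distinct : ∀ {n} {a b : Fin n} (l : Fin n) → a ≢ b → δ a l * δ b l ≡ 0ℚ
δ-mul-distinct {a = a} {b} l a≢b with a ≟ l
... | yes refl = trans (cong (1ℚ *_) (δ-≢ (a≢b ∘ sym))) (*-zeroʳ 1ℚ)
... | no _     = *-zeroˡ (δ b l)

Σ-δ : ∀ {n} (l : Fin n) (c : Fin n → ℚ) → Σ[ n ] (λ j → δ j l * c j) ≡ c l
Σ-δ {suc n} zero c = begin
  Σ[ suc n ] (λ j → δ j zero * c j)             ≡⟨ Σ-suc (λ j → δ j zero * c j) ⟩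
  1ℚ * c zero + Σ[ n ] (λ j → 0ℚ * c (suc j))   ≡⟨ cong₂ _+_ (*-identityˡ (c zero)) Σ0≡0 ⟩
  c zero + 0ℚ                                   ≡⟨ +-identityʳ (c zero) ⟩
  c zero                                        ∎
  where
  Σ0≡0 : Σ[ n ] (λ j → 0ℚ * c (suc j)) ≡ 0ℚ
  Σ0≡0 = trans (Σ-cong (λ j → *-zeroˡ (c (suc j)))) (sumOver-zero (allFin n))
Σ-δ {suc n} (suc l) c = begin
  Σ[ suc n ] (λ j → δ j (suc l) * c j)               ≡⟨ Σ-suc (λ j → δ j (suc l) * c j) ⟩
  0ℚ * c zero + Σ[ n ] (λ j → δ j l * c (suc j))     ≡⟨ cong₂ _+_ (*-zeroˡ (c zero)) (Σ-δ l (c ∘ suc)) ⟩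
  0ℚ + c (suc l)                                     ≡⟨ +-identityˡ (c (suc l)) ⟩
  c (suc l)                                          ∎

Σ-δ-complement : ∀ {n} (l : Fin n) (c : Fin n → ℚ) → Σ[ n ] (λ j → (1ℚ - δ j l) * c j) ≡ Σ[ n ] c - c l
Σ-δ-complement {n} l c = begin
  Σ[ n ] (λ j → (1ℚ - δ j l) * c j)
    ≡⟨ Σ-cong (λ j → expand (δ j l) (c j)) ⟩
  Σ[ n ] (λ j → 1ℚ * c j + (- 1ℚ) * (δ j l * c j))
    ≡⟨ sumOver-linear (allFin n) 1ℚ (- 1ℚ) c (λ j → δ j l * c j) ⟩
  1ℚ * Σ[ n ] c + (- 1ℚ) * Σ[ n ] (λ j → δ j l * c j)
    ≡⟨ cong (λ t → 1ℚ * Σ[ n ] c + (- 1ℚ) * t) (Σ-δ l c) ⟩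
  1ℚ * Σ[ n ] c + (- 1ℚ) * c l
    ≡⟨ solve 2 (λ s t → con 1ℚ :* s :+ con (- 1ℚ) :* t := s :- t) refl (Σ[ n ] c) (c l) ⟩
  Σ[ n ] c - c l
    ∎
  where
  expand : ∀ d t → (1ℚ - d) * t ≡ 1ℚ * t + (- 1ℚ) * (d * t)
  expand = solve 2 (λ d t → (con 1ℚ :- d) :* t := con 1ℚ :* t :+ con (- 1ℚ) :* (d :* t)) refl

x≡δ : ∀ {n} (i j : Fin n) π → x i j π ≡ δ (V.lookup π i) j
x≡δ i j π with V.lookup π i ≟ j
... | yes _ = refl
... | no _  = refl

-- The decision procedure of Defs, so that Sym n is definitionally filter isPerm? (allVecs n n).
isPerm? : ∀ {n} (v : V.Vec (Fin n) n) → Dec (IsPerm v)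
isPerm? v = all? (λ i → all? (λ j → (V.lookup v i ≟ V.lookup v j) →-dec (i ≟ j)))

Sym⇒IsPerm : ∀ {n} {π : V.Vec (Fin n) n} → π ∈ Sym n → IsPerm π
Sym⇒IsPerm {n} π∈Sym = proj₂ (∈-filter⁻ isPerm? {xs = allVecs n n} π∈Sym)

allVecs-suc : ∀ n k (F : V.Vec (Fin n) (suc k) → ℚ) →
              sumOver (allVecs n (suc k)) F ≡ Σ[ n ] (λ i → sumOver (allVecs n k) (F ∘ (i V.∷_)))
allVecs-suc n k F = trans (sumOver-concatMap (λ i → map (i V.∷_) (allVecs n k)) (allFin n) F)
  (Σ-cong (λ i → sumOver-map (i V.∷_) (allVecs n k) F))

allVecs-complete : ∀ n k (v : V.Vec (Fin n) k) → v ∈ allVecs n k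
allVecs-complete n zero    V.[]       = here refl
allVecs-complete n (suc k) (i V.∷ v) =
  ∈-concatMap⁺ (λ j → map (j V.∷_) (allVecs n k))
    (lose (∈-allFin i) (∈-map⁺ (i V.∷_) (allVecs-complete n k v)))

id∈Sym : ∀ n → V.allFin n ∈ Sym n
id∈Sym n = ∈-filter⁺ isPerm? (allVecs-complete n n (V.allFin n))
  (λ i j eq → trans (sym (V.lookup-allFin i)) (trans eq (V.lookup-allFin j)))

∈⇒length-nonZero : {A : Set} {a : A} {L : List A} → a ∈ L → ℕ.NonZero (length L)
∈⇒length-nonZero {L = _ ∷ _} _ = _

∣Sym∣ : ℕ → ℚ
∣Sym∣ n = ℕ→ℚ (length (Sym n))

-- Counting permutations with prescribed values

count : ∀ {n} → Fin n → Fin n → ℚ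
count {n} k l = sumOver (Sym n) (x k l)

joint : ∀ {n} → Fin n → Fin n → Fin n → Fin n → ℚ
joint {n} i j k l = sumOver (Sym n) (λ π → x i j π * x k l π)

transpose-matchˡ : ∀ {n} (i j : Fin n) → transpose i j ⟨$⟩ʳ i ≡ j
transpose-matchˡ i j rewrite dec-true (i ≟ i) refl = refl

transpose-fixes : ∀ {n} {i j k : Fin n} → k ≢ i → k ≢ j → transpose i j ⟨$⟩ʳ k ≡ k
transpose-fixes {i = i} {j} {k} k≢i k≢j rewrite dec-false (k ≟ i) k≢i | dec-false (k ≟ j) k≢j = refl

module _ {n} (σ : Permutation′ n) where

  private
    σ-injective : ∀ {i j} → σ ⟨$⟩ʳ i ≡ σ ⟨$⟩ʳ j → i ≡ j
    σ-injective = Injection.injective (↔⇒↣ σ)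

    σ* : ∀ {k} → V.Vec (Fin n) k → V.Vec (Fin n) k
    σ* = V.map (σ ⟨$⟩ʳ_)

  δ-permute : ∀ i j → δ (σ ⟨$⟩ʳ i) (σ ⟨$⟩ʳ j) ≡ δ i j
  δ-permute i j = 𝟙-cong σ-injective (cong (σ ⟨$⟩ʳ_)) (σ ⟨$⟩ʳ i ≟ σ ⟨$⟩ʳ j) (i ≟ j)

  IsPerm-map⁺ : ∀ {v} → IsPerm v → IsPerm (σ* v)
  IsPerm-map⁺ {v} v-perm i j σvᵢ≡σvⱼ = v-perm i j (σ-injective (begin
    σ ⟨$⟩ʳ V.lookup v i   ≡˘⟨ V.lookup-map i (σ ⟨$⟩ʳ_) v ⟩
    V.lookup (σ* v) i     ≡⟨ σvᵢ≡σvⱼ ⟩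
    V.lookup (σ* v) j     ≡⟨ V.lookup-map j (σ ⟨$⟩ʳ_) v ⟩
    σ ⟨$⟩ʳ V.lookup v j   ∎))

  IsPerm-map⁻ : ∀ {v} → IsPerm (σ* v) → IsPerm v
  IsPerm-map⁻ {v} σv-perm i j vᵢ≡vⱼ = σv-perm i j (begin
    V.lookup (σ* v) i     ≡⟨ V.lookup-map i (σ ⟨$⟩ʳ_) v ⟩
    σ ⟨$⟩ʳ V.lookup v i   ≡⟨ cong (σ ⟨$⟩ʳ_) vᵢ≡vⱼ ⟩
    σ ⟨$⟩ʳ V.lookup v j   ≡˘⟨ V.lookup-map j (σ ⟨$⟩ʳ_) v ⟩
    V.lookup (σ* v) j     ∎)

  allVecs-map : ∀ k (F : V.Vec (Fin n) k → ℚ) → sumOver (allVecs n k) (F ∘ σ*) ≡ sumOver (allVecs n k) F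
  allVecs-map zero    F = refl
  allVecs-map (suc k) F = begin
    sumOver (allVecs n (suc k)) (F ∘ σ*)
      ≡⟨ allVecs-suc n k (F ∘ σ*) ⟩
    Σ[ n ] (λ i → sumOver (allVecs n k) (F ∘ σ* ∘ (i V.∷_)))
      ≡⟨ Σ-cong (λ i → allVecs-map k (F ∘ ((σ ⟨$⟩ʳ i) V.∷_))) ⟩
    Σ[ n ] (λ i → sumOver (allVecs n k) (F ∘ ((σ ⟨$⟩ʳ i) V.∷_)))
      ≡⟨ Σ-permute σ (λ i → sumOver (allVecs n k) (F ∘ (i V.∷_))) ⟩
    Σ[ n ] (λ i → sumOver (allVecs n k) (F ∘ (i V.∷_)))
      ≡˘⟨ allVecs-suc n k F ⟩
    sumOver (allVecs n (suc k)) F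
      ∎

  Sym-map : ∀ (F : V.Vec (Fin n) n → ℚ) → sumOver (Sym n) (F ∘ σ*) ≡ sumOver (Sym n) F
  Sym-map F = begin
    sumOver (Sym n) (F ∘ σ*)
      ≡⟨ sumOver-filter isPerm? (allVecs n n) (F ∘ σ*) ⟩
    sumOver (allVecs n n) (λ v → 𝟙 (isPerm? v) * F (σ* v))
      ≡⟨ sumOver-cong (allVecs n n) (λ v → cong (_* F (σ* v)) (isPerm?-σ* v)) ⟩
    sumOver (allVecs n n) (λ v → 𝟙 (isPerm? (σ* v)) * F (σ* v))
      ≡⟨ allVecs-map n (λ v → 𝟙 (isPerm? v) * F v) ⟩
    sumOver (allVecs n n) (λ v → 𝟙 (isPerm? v) * F v)
      ≡˘⟨ sumOver-filter isPerm? (allVecs n n) F ⟩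
    sumOver (Sym n) F
      ∎
    where
    isPerm?-σ* : ∀ v → 𝟙 (isPerm? v) ≡ 𝟙 (isPerm? (σ* v))
    isPerm?-σ* v = 𝟙-cong (IsPerm-map⁺ {v}) (IsPerm-map⁻ {v}) (isPerm? v) (isPerm? (σ* v))

  x-permute : ∀ k l π → x k (σ ⟨$⟩ʳ l) (σ* π) ≡ x k l π
  x-permute k l π = begin
    x k (σ ⟨$⟩ʳ l) (σ* π)                ≡⟨ x≡δ k (σ ⟨$⟩ʳ l) (σ* π) ⟩
    δ (V.lookup (σ* π) k) (σ ⟨$⟩ʳ l)      ≡⟨ cong (λ y → δ y (σ ⟨$⟩ʳ l)) (V.lookup-map k _ π) ⟩
    δ (σ ⟨$⟩ʳ V.lookup π k) (σ ⟨$⟩ʳ l)    ≡⟨ δ-permute (V.lookup π k) l ⟩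
    δ (V.lookup π k) l                   ≡˘⟨ x≡δ k l π ⟩
    x k l π                              ∎

  count-permute : ∀ k l → count k (σ ⟨$⟩ʳ l) ≡ count k l
  count-permute k l = trans (sym (Sym-map (x k (σ ⟨$⟩ʳ l)))) (sumOver-cong (Sym n) (x-permute k l))

  joint-permute : ∀ i j k l → joint i (σ ⟨$⟩ʳ j) k (σ ⟨$⟩ʳ l) ≡ joint i j k l
  joint-permute i j k l = trans (sym (Sym-map (λ π → x i (σ ⟨$⟩ʳ j) π * x k (σ ⟨$⟩ʳ l) π)))
    (sumOver-cong (Sym n) (λ π → cong₂ _*_ (x-permute i j π) (x-permute k l π)))

Σ-x : ∀ {n} (k : Fin n) π → Σ[ n ] (λ l → x k l π) ≡ 1ℚ
Σ-x k π = trans (Σ-cong (λ l → trans (x≡δ k l π) (trans (δ-sym (V.lookup π k) l) (sym (*-identityʳ _)))))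
                (Σ-δ (V.lookup π k) (const 1ℚ))

count-row-sum : ∀ {n} (k : Fin n) → Σ[ n ] (count k) ≡ ∣Sym∣ n
count-row-sum {n} k = begin
  Σ[ n ] (count k)                               ≡⟨ sumOver-comm (allFin n) (Sym n) (λ l π → x k l π) ⟩
  sumOver (Sym n) (λ π → Σ[ n ] (λ l → x k l π)) ≡⟨ sumOver-cong (Sym n) (Σ-x k) ⟩
  sumOver (Sym n) (const 1ℚ)                     ≡⟨ sumOver-const (Sym n) 1ℚ ⟩
  ∣Sym∣ n * 1ℚ                                    ≡⟨ *-identityʳ (∣Sym∣ n) ⟩
  ∣Sym∣ n                                         ∎

count-uniform : ∀ {n} (k l : Fin n) → ℕ→ℚ n * count k l ≡ ∣Sym∣ n
count-uniform {n} k l = begin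
  ℕ→ℚ n * count k l           ≡˘⟨ Σ-const (count k l) ⟩
  Σ[ n ] (const (count k l))  ≡˘⟨ Σ-cong (λ l′ → trans (cong (count k) (sym (transpose-matchˡ l l′)))
                                                        (count-permute (transpose l l′) k l)) ⟩
  Σ[ n ] (count k)            ≡⟨ count-row-sum k ⟩
  ∣Sym∣ n                      ∎

joint-same-row : ∀ {n} (k j l : Fin n) → joint k j k l ≡ δ j l * count k l
joint-same-row {n} k j l = trans (sumOver-cong (Sym n) pointwise) (sumOver-*ˡ (Sym n) (δ j l) (x k l))
  where
  pointwise : ∀ π → x k j π * x k l π ≡ δ j l * x k l π
  pointwise π = begin
    x k j π * x k l π                            ≡⟨ cong₂ _*_ (x≡δ k j π) (x≡δ k l π) ⟩
    δ (V.lookup π k) j * δ (V.lookup π k) l      ≡⟨ δ-mul-same (V.lookup π k) j l ⟩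
    δ j l * δ (V.lookup π k) l                   ≡˘⟨ cong (δ j l *_) (x≡δ k l π) ⟩
    δ j l * x k l π                              ∎

joint-same-column : ∀ {n} {i k : Fin n} (l : Fin n) → i ≢ k → joint i l k l ≡ 0ℚ
joint-same-column {n} {i} {k} l i≢k = trans (sumOver-cong-∈ (Sym n) pointwise) (sumOver-zero (Sym n))
  where
  pointwise : ∀ {π} → π ∈ Sym n → x i l π * x k l π ≡ 0ℚ
  pointwise {π} π∈Sym = trans (cong₂ _*_ (x≡δ i l π) (x≡δ k l π))
    (δ-mul-distinct l (i≢k ∘ Sym⇒IsPerm π∈Sym i k))

joint-row-sum : ∀ {n} (i k l : Fin n) → Σ[ n ] (λ j → joint i j k l) ≡ count k l
joint-row-sum {n} i k l = begin
  Σ[ n ] (λ j → joint i j k l)                             ≡⟨ sumOver-comm (allFin n) (Sym n) (λ j π → x i j π * x k l π) ⟩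
  sumOver (Sym n) (λ π → Σ[ n ] (λ j → x i j π * x k l π)) ≡⟨ sumOver-cong (Sym n) row-sum ⟩
  count k l                                                ∎
  where
  row-sum : ∀ π → Σ[ n ] (λ j → x i j π * x k l π) ≡ x k l π
  row-sum π = begin
    Σ[ n ] (λ j → x i j π * x k l π)  ≡⟨ sumOver-*ʳ (allFin n) (x k l π) (λ j → x i j π) ⟩
    Σ[ n ] (λ j → x i j π) * x k l π  ≡⟨ cong (_* x k l π) (Σ-x i π) ⟩
    1ℚ * x k l π                      ≡⟨ *-identityˡ (x k l π) ⟩
    x k l π                           ∎

-- The n - 1 columns j′ ≠ l all carry the same joint count (swap j and j′), and column l carries none.
joint-off-diagonal : ∀ {m} {i j k l : Fin (suc m)} → i ≢ k → j ≢ l → ℕ→ℚ m * joint i j k l ≡ count k l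
joint-off-diagonal {m} {i} {j} {k} {l} i≢k j≢l = sym (begin
  count k l                                 ≡˘⟨ joint-row-sum i k l ⟩
  Σ[ suc m ] (λ j′ → joint i j′ k l)          ≡⟨ Σ-cong (λ j′ → joint-by-column j′ (j′ ≟ l)) ⟩
  Σ[ suc m ] (λ j′ → (1ℚ - δ j′ l) * Q)       ≡⟨ Σ-δ-complement l (const Q) ⟩
  Σ[ suc m ] (const Q) - Q                  ≡⟨ cong (_- Q) (trans (Σ-const Q) (cong (_* Q) (ℕ→ℚ-suc m))) ⟩
  (1ℚ + ℕ→ℚ m) * Q - Q                       ≡⟨ cancel (ℕ→ℚ m) Q ⟩
  ℕ→ℚ m * Q                                  ∎)
  where
  Q = joint i j k l
  cancel : ∀ c q → (1ℚ + c) * q - q ≡ c * q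
  cancel = solve 2 (λ c q → (con 1ℚ :+ c) :* q :- q := c :* q) refl
  joint-by-column : ∀ j′ → Dec (j′ ≡ l) → joint i j′ k l ≡ (1ℚ - δ j′ l) * Q
  joint-by-column j′ (yes refl) = begin
    joint i l k l          ≡⟨ joint-same-column l i≢k ⟩
    0ℚ                     ≡⟨ solve 1 (λ q → con 0ℚ := (con 1ℚ :- con 1ℚ) :* q) refl Q ⟩
    (1ℚ - 1ℚ) * Q          ≡˘⟨ cong (λ d → (1ℚ - d) * Q) (δ-refl l) ⟩
    (1ℚ - δ l l) * Q       ∎
  joint-by-column j′ (no j′≢l) = begin
    joint i j′ k l                        ≡˘⟨ cong₂ (λ u v → joint i u k v) (transpose-matchˡ j j′)
                                                  (transpose-fixes (j≢l ∘ sym) (j′≢l ∘ sym)) ⟩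
    joint i (τ ⟨$⟩ʳ j) k (τ ⟨$⟩ʳ l)         ≡⟨ joint-permute τ i j k l ⟩
    Q                                     ≡⟨ solve 1 (λ q → q := (con 1ℚ :- con 0ℚ) :* q) refl Q ⟩
    (1ℚ - 0ℚ) * Q                         ≡˘⟨ cong (λ d → (1ℚ - d) * Q) (δ-≢ j′≢l) ⟩
    (1ℚ - δ j′ l) * Q                     ∎
    where
    τ = transpose j j′

-- With c = n - 1, d = δ i k and e = δ j l this is (n - 1) · joint i j k l / count k l.
jointWeight : ℚ → ℚ → ℚ → ℚ
jointWeight c d e = c * (d * e) + (1ℚ - d) * (1ℚ - e)

joint-formula : ∀ {m} (i j k l : Fin (suc m)) →
                ℕ→ℚ m * joint i j k l ≡ count k l * jointWeight (ℕ→ℚ m) (δ i k) (δ j l)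
joint-formula {m} i j k l with i ≟ k | j ≟ l
... | yes refl | yes refl = begin
  ℕ→ℚ m * joint i j i j                  ≡⟨ cong (ℕ→ℚ m *_) (joint-same-row i j j) ⟩
  ℕ→ℚ m * (δ j j * count i j)            ≡⟨ cong (λ d → ℕ→ℚ m * (d * count i j)) (δ-refl j) ⟩
  ℕ→ℚ m * (1ℚ * count i j)               ≡⟨ weight (ℕ→ℚ m) (count i j) ⟩
  count i j * jointWeight (ℕ→ℚ m) 1ℚ 1ℚ  ∎
  where
  weight : ∀ c N → c * (1ℚ * N) ≡ N * jointWeight c 1ℚ 1ℚ
  weight = solve 2 (λ c N → c :* (con 1ℚ :* N)
                         := N :* (c :* (con 1ℚ :* con 1ℚ) :+ (con 1ℚ :- con 1ℚ) :* (con 1ℚ :- con 1ℚ))) refl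
... | yes refl | no j≢l = begin
  ℕ→ℚ m * joint i j i l                  ≡⟨ cong (ℕ→ℚ m *_) (joint-same-row i j l) ⟩
  ℕ→ℚ m * (δ j l * count i l)            ≡⟨ cong (λ d → ℕ→ℚ m * (d * count i l)) (δ-≢ j≢l) ⟩
  ℕ→ℚ m * (0ℚ * count i l)               ≡⟨ weight (ℕ→ℚ m) (count i l) ⟩
  count i l * jointWeight (ℕ→ℚ m) 1ℚ 0ℚ  ∎
  where
  weight : ∀ c N → c * (0ℚ * N) ≡ N * jointWeight c 1ℚ 0ℚ
  weight = solve 2 (λ c N → c :* (con 0ℚ :* N)
                         := N :* (c :* (con 1ℚ :* con 0ℚ) :+ (con 1ℚ :- con 1ℚ) :* (con 1ℚ :- con 0ℚ))) refl
... | no i≢k | yes refl = begin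
  ℕ→ℚ m * joint i j k j                  ≡⟨ cong (ℕ→ℚ m *_) (joint-same-column j i≢k) ⟩
  ℕ→ℚ m * 0ℚ                             ≡⟨ weight (ℕ→ℚ m) (count k j) ⟩
  count k j * jointWeight (ℕ→ℚ m) 0ℚ 1ℚ  ∎
  where
  weight : ∀ c N → c * 0ℚ ≡ N * jointWeight c 0ℚ 1ℚ
  weight = solve 2 (λ c N → c :* con 0ℚ
                         := N :* (c :* (con 0ℚ :* con 1ℚ) :+ (con 1ℚ :- con 0ℚ) :* (con 1ℚ :- con 1ℚ))) refl
... | no i≢k | no j≢l = begin
  ℕ→ℚ m * joint i j k l                  ≡⟨ joint-off-diagonal i≢k j≢l ⟩
  count k l                              ≡⟨ weight (ℕ→ℚ m) (count k l) ⟩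
  count k l * jointWeight (ℕ→ℚ m) 0ℚ 0ℚ  ∎
  where
  weight : ∀ c N → N ≡ N * jointWeight c 0ℚ 0ℚ
  weight = solve 2 (λ c N → N
                         := N :* (c :* (con 0ℚ :* con 0ℚ) :+ (con 1ℚ :- con 0ℚ) :* (con 1ℚ :- con 0ℚ))) refl

-- Normalized matrices and linear functions

Σ-jointWeight-row : ∀ {n} (r : Fin n → ℚ) → Σ[ n ] r ≡ 0ℚ → ∀ c d l →
                    Σ[ n ] (λ j → r j * jointWeight c d (δ j l)) ≡ c * (d * r l) + (- 1ℚ) * ((1ℚ - d) * r l)
Σ-jointWeight-row {n} r Σr≡0 c d l = begin
  Σ[ n ] (λ j → r j * jointWeight c d (δ j l))
    ≡⟨ Σ-cong (λ j → expand (r j) (δ j l)) ⟩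
  Σ[ n ] (λ j → (c * d) * (δ j l * r j) + (1ℚ - d) * ((1ℚ - δ j l) * r j))
    ≡⟨ sumOver-linear (allFin n) (c * d) (1ℚ - d) (λ j → δ j l * r j) (λ j → (1ℚ - δ j l) * r j) ⟩
  (c * d) * Σ[ n ] (λ j → δ j l * r j) + (1ℚ - d) * Σ[ n ] (λ j → (1ℚ - δ j l) * r j)
    ≡⟨ cong₂ (λ s t → (c * d) * s + (1ℚ - d) * t) (Σ-δ l r)
             (trans (Σ-δ-complement l r) (cong (_- r l) Σr≡0)) ⟩
  (c * d) * r l + (1ℚ - d) * (0ℚ - r l)
    ≡⟨ collect (r l) ⟩
  c * (d * r l) + (- 1ℚ) * ((1ℚ - d) * r l)
    ∎
  where
  expand : ∀ t e → t * jointWeight c d e ≡ (c * d) * (e * t) + (1ℚ - d) * ((1ℚ - e) * t)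
  expand = solve 4 (λ c d t e → t :* (c :* (d :* e) :+ (con 1ℚ :- d) :* (con 1ℚ :- e))
                              := (c :* d) :* (e :* t) :+ (con 1ℚ :- d) :* ((con 1ℚ :- e) :* t)) refl c d
  collect : ∀ t → (c * d) * t + (1ℚ - d) * (0ℚ - t) ≡ c * (d * t) + (- 1ℚ) * ((1ℚ - d) * t)
  collect = solve 3 (λ c d t → (c :* d) :* t :+ (con 1ℚ :- d) :* (con 0ℚ :- t)
                            := c :* (d :* t) :+ con (- 1ℚ) :* ((con 1ℚ :- d) :* t)) refl c d

Σ-jointWeight : ∀ {n} (a : Fin n → Fin n → ℚ) → Normalized a → ∀ c k l →
                Σ[ n ] (λ i → Σ[ n ] (λ j → a i j * jointWeight c (δ i k) (δ j l))) ≡ (1ℚ + c) * a k l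
Σ-jointWeight {n} a (rows≡0 , columns≡0) c k l = begin
  Σ[ n ] (λ i → Σ[ n ] (λ j → a i j * jointWeight c (δ i k) (δ j l)))
    ≡⟨ Σ-cong (λ i → Σ-jointWeight-row (a i) (rows≡0 i) c (δ i k) l) ⟩
  Σ[ n ] (λ i → c * (δ i k * a i l) + (- 1ℚ) * ((1ℚ - δ i k) * a i l))
    ≡⟨ sumOver-linear (allFin n) c (- 1ℚ) (λ i → δ i k * a i l) (λ i → (1ℚ - δ i k) * a i l) ⟩
  c * Σ[ n ] (λ i → δ i k * a i l) + (- 1ℚ) * Σ[ n ] (λ i → (1ℚ - δ i k) * a i l)
    ≡⟨ cong₂ (λ s t → c * s + (- 1ℚ) * t) (Σ-δ k (λ i → a i l))
             (trans (Σ-δ-complement k (λ i → a i l)) (cong (_- a k l) (columns≡0 l))) ⟩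
  c * a k l + (- 1ℚ) * (0ℚ - a k l)
    ≡⟨ solve 2 (λ c t → c :* t :+ con (- 1ℚ) :* (con 0ℚ :- t) := (con 1ℚ :+ c) :* t) refl c (a k l) ⟩
  (1ℚ + c) * a k l
    ∎

sumOver-linFun* : ∀ {n} (a : Fin n → Fin n → ℚ) L (w : V.Vec (Fin n) n → ℚ) →
                  sumOver L (λ π → linFun a π * w π)
                  ≡ Σ[ n ] (λ i → Σ[ n ] (λ j → a i j * sumOver L (λ π → x i j π * w π)))
sumOver-linFun* {n} a L w = begin
  sumOver L (λ π → linFun a π * w π)
    ≡⟨ sumOver-cong L expand ⟩
  sumOver L (λ π → Σ[ n ] (λ i → Σ[ n ] (λ j → a i j * (x i j π * w π))))
    ≡⟨ sumOver-comm L (allFin n) (λ π i → Σ[ n ] (λ j → a i j * (x i j π * w π))) ⟩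
  Σ[ n ] (λ i → sumOver L (λ π → Σ[ n ] (λ j → a i j * (x i j π * w π))))
    ≡⟨ Σ-cong (λ i → sumOver-comm L (allFin n) (λ π j → a i j * (x i j π * w π))) ⟩
  Σ[ n ] (λ i → Σ[ n ] (λ j → sumOver L (λ π → a i j * (x i j π * w π))))
    ≡⟨ Σ-cong (λ i → Σ-cong (λ j → sumOver-*ˡ L (a i j) (λ π → x i j π * w π))) ⟩
  Σ[ n ] (λ i → Σ[ n ] (λ j → a i j * sumOver L (λ π → x i j π * w π)))
    ∎
  where
  expand : ∀ π → linFun a π * w π ≡ Σ[ n ] (λ i → Σ[ n ] (λ j → a i j * (x i j π * w π)))
  expand π = trans (sym (sumOver-*ʳ (allFin n) (w π) (λ i → Σ[ n ] (λ j → a i j * x i j π))))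
    (Σ-cong (λ i → trans (sym (sumOver-*ʳ (allFin n) (w π) (λ j → a i j * x i j π)))
                         (Σ-cong (λ j → *-assoc (a i j) (x i j π) (w π)))))

sumSym-x*linFun : ∀ {m} (a : Fin (suc m) → Fin (suc m) → ℚ) → Normalized a → ∀ k l →
                  ℕ→ℚ m * sumOver (Sym (suc m)) (λ π → x k l π * linFun a π) ≡ ∣Sym∣ (suc m) * a k l
sumSym-x*linFun {m} a a-normalized k l = begin
  ℕ→ℚ m * sumOver (Sym n) (λ π → x k l π * linFun a π)
    ≡⟨ cong (ℕ→ℚ m *_) (trans (sumOver-cong (Sym n) (λ π → *-comm (x k l π) (linFun a π)))
                               (sumOver-linFun* a (Sym n) (x k l))) ⟩
  ℕ→ℚ m * Σ[ n ] (λ i → Σ[ n ] (λ j → a i j * joint i j k l))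
    ≡⟨ Σ²-*ˡ (ℕ→ℚ m) (λ i j → a i j * joint i j k l) ⟩
  Σ[ n ] (λ i → Σ[ n ] (λ j → ℕ→ℚ m * (a i j * joint i j k l)))
    ≡⟨ Σ-cong (λ i → Σ-cong (λ j → begin
         ℕ→ℚ m * (a i j * joint i j k l)       ≡⟨ x∙yz≈y∙xz (ℕ→ℚ m) (a i j) (joint i j k l) ⟩
         a i j * (ℕ→ℚ m * joint i j k l)       ≡⟨ cong (a i j *_) (joint-formula i j k l) ⟩
         a i j * (count k l * w i j)            ≡⟨ x∙yz≈y∙xz (a i j) (count k l) (w i j) ⟩
         count k l * (a i j * w i j)            ∎)) ⟩
  Σ[ n ] (λ i → Σ[ n ] (λ j → count k l * (a i j * w i j)))
    ≡˘⟨ Σ²-*ˡ (count k l) (λ i j → a i j * w i j) ⟩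
  count k l * Σ[ n ] (λ i → Σ[ n ] (λ j → a i j * w i j))
    ≡⟨ cong (count k l *_) (Σ-jointWeight a a-normalized (ℕ→ℚ m) k l) ⟩
  count k l * ((1ℚ + ℕ→ℚ m) * a k l)
    ≡⟨ x∙yz≈y∙xz (count k l) (1ℚ + ℕ→ℚ m) (a k l) ⟩
  (1ℚ + ℕ→ℚ m) * (count k l * a k l)
    ≡˘⟨ *-assoc (1ℚ + ℕ→ℚ m) (count k l) (a k l) ⟩
  ((1ℚ + ℕ→ℚ m) * count k l) * a k l
    ≡⟨ cong (λ c → (c * count k l) * a k l) (sym (ℕ→ℚ-suc m)) ⟩
  (ℕ→ℚ n * count k l) * a k l
    ≡⟨ cong (_* a k l) (count-uniform k l) ⟩
  ∣Sym∣ n * a k l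
    ∎
  where
  n = suc m
  w : Fin n → Fin n → ℚ
  w i j = jointWeight (ℕ→ℚ m) (δ i k) (δ j l)

sumSym-linFun*linFun : ∀ {m} (a b : Fin (suc m) → Fin (suc m) → ℚ) → Normalized a →
                       ℕ→ℚ m * sumOver (Sym (suc m)) (λ π → linFun a π * linFun b π)
                       ≡ ∣Sym∣ (suc m) * Σ[ suc m ] (λ i → Σ[ suc m ] (λ j → a i j * b i j))
sumSym-linFun*linFun {m} a b a-normalized = begin
  ℕ→ℚ m * sumOver (Sym n) (λ π → linFun a π * linFun b π)
    ≡⟨ cong (ℕ→ℚ m *_) (trans (sumOver-cong (Sym n) (λ π → *-comm (linFun a π) (linFun b π)))
                               (sumOver-linFun* b (Sym n) (linFun a))) ⟩
  ℕ→ℚ m * Σ[ n ] (λ k → Σ[ n ] (λ l → b k l * E k l))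
    ≡⟨ Σ²-*ˡ (ℕ→ℚ m) (λ k l → b k l * E k l) ⟩
  Σ[ n ] (λ k → Σ[ n ] (λ l → ℕ→ℚ m * (b k l * E k l)))
    ≡⟨ Σ-cong (λ k → Σ-cong (λ l → begin
         ℕ→ℚ m * (b k l * E k l)     ≡⟨ x∙yz≈y∙xz (ℕ→ℚ m) (b k l) (E k l) ⟩
         b k l * (ℕ→ℚ m * E k l)     ≡⟨ cong (b k l *_) (sumSym-x*linFun a a-normalized k l) ⟩
         b k l * (∣Sym∣ n * a k l)    ≡⟨ x∙yz≈y∙xz (b k l) (∣Sym∣ n) (a k l) ⟩
         ∣Sym∣ n * (b k l * a k l)    ≡⟨ cong (∣Sym∣ n *_) (*-comm (b k l) (a k l)) ⟩
         ∣Sym∣ n * (a k l * b k l)    ∎)) ⟩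
  Σ[ n ] (λ k → Σ[ n ] (λ l → ∣Sym∣ n * (a k l * b k l)))
    ≡˘⟨ Σ²-*ˡ (∣Sym∣ n) (λ k l → a k l * b k l) ⟩
  ∣Sym∣ n * Σ[ n ] (λ i → Σ[ n ] (λ j → a i j * b i j))
    ∎
  where
  n = suc m
  E : Fin n → Fin n → ℚ
  E k l = sumOver (Sym n) (λ π → x k l π * linFun a π)

lemma3p1 : (n : ℕ) → 2 ≤ n → (a b : Fin n → Fin n → ℚ) → Normalized a →
    inner (linFun a) (linFun b) ≡ divBy (Σ[ n ] (λ i → Σ[ n ] (λ j → a i j * b i j))) (n ∸ 1)
lemma3p1 n@(suc (suc m)) (s≤s (s≤s z≤n)) a b a-normalized =
  divBy-cross {Y = Σ[ n ] (λ i → Σ[ n ] (λ j → a i j * b i j))} (suc m) (length (Sym n))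
    (sumSym-linFun*linFun a b a-normalized)
  where
  instance
    Sym-nonZero : ℕ.NonZero (length (Sym n))
    Sym-nonZero = ∈⇒length-nonZero (id∈Sym n)
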